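{- Let $\Sigma\subseteq\mathcal L$ be closed under subformulas, let $\mathcal X=(W,T,\le,S,[\![\cdot]\!])$ be a bi-relational model, regarded as the structure on $W\times T$ with $\ell(x)=\{\psi\in\Sigma: x\in[\![\psi]\!]\}$, order $(w,t)\le(w',t')$ iff $t=t'$ and $w\le w'$, and relation $R=\{((w,t),(w,S(t))):w\in W,t\in T\}$. Let $\mathcal Q=((W\times T)/{\sim},\le_{\mathcal Q},\ell_{\mathcal Q},R^+_{\mathcal Q})$ be its quotient, where $L(x)=\{\ell(y): y\le x\text{ or }x\le y\}$, $x\sim y$ iff $(\ell(x),L(x))=(\ell(y),L(y))$, $[x]\le_{\mathcal Q}[y]$ iff $L(x)=L(y)$ and $\ell(x)\supseteq\ell(y)$, $\ell_{\mathcal Q}([x])=\ell(x)$, $R_{\mathcal Q}$ is the smallest relation with $xRy\Rightarrow[x]R_{\mathcal Q}[y]$, and $XR^+_{\mathcal Q}Y$ iff there exist $X_1\le_{\mathcal Q}X\le_{\mathcal Q}X_2$, $Y_1\le_{\mathcal Q}Y\le_{\mathcal Q}Y_2$ with $X_2R_{\mathcal Q}Y_1$ and $X_1R_{\mathcal Q}Y_2$. Let $\varphi\in\Sigma$. Then $\mathcal X$ falsifies $\varphi$ (i.e. $[\![\varphi]\!]\ne W\times T$) if and only if $\mathcal Q$ falsifies $\varphi$ (i.e. $\varphi\in\Sigma\setminus\ell_{\mathcal Q}(X)$ for some $X\in(W\times T)/{\sim}$).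
   Context: The language $\mathcal L$ over a countably infinite set $\mathbb P$ of variables: $\varphi ::= p\mid\varphi\wedge\psi\mid\varphi\vee\psi\mid\varphi\Rightarrow\psi\mid\varphi\Leftarrow\psi\mid\mathsf X\varphi\mid\mathsf Y\varphi\mid\mathsf G\varphi\mid\mathsf H\varphi\mid\varphi\,\mathsf U\,\psi\mid\varphi\,\mathsf S\,\psi$. Bi-relational model: $(W,T,\le,S,[\![\cdot]\!])$ with $(W,\le)$ linear, $S:T\to T$ a bijection, $\vec S(w,t)=(w,S(t))$, each $[\![p]\!]\subseteq W\times T$ downward closed in the first coordinate, and $[\![\varphi\wedge\psi]\!]=[\![\varphi]\!]\cap[\![\psi]\!]$, $[\![\varphi\vee\psi]\!]=[\![\varphi]\!]\cup[\![\psi]\!]$, $(w,t)\in[\![\varphi\Rightarrow\psi]\!]$ iff $\forall v\le w\,((v,t)\in[\![\varphi]\!]\Rightarrow(v,t)\in[\![\psi]\!])$, $(w,t)\in[\![\varphi\Leftarrow\psi]\!]$ iff $\exists v\ge w\,((v,t)\in[\![\varphi]\!]\setminus[\![\psi]\!])$, $[\![\mathsf X\varphi]\!]=\vec S^{ -1}[\![\varphi]\!]$, $[\![\mathsf Y\varphi]\!]=\vec S[\![\varphi]\!]$, $[\![\mathsf G\varphi]\!]=\bigcap_{n\ge0}\vec S^{ -n}[\![\varphi]\!]$, $[\![\mathsf H\varphi]\!]=\bigcap_{n\ge0}\vec S^{n}[\![\varphi]\!]$, $[\![\varphi\,\mathsf U\,\psi]\!]=\bigcup_{n\ge0}(\bigcap_{i<n}\vec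 S^{ -i}[\![\varphi]\!]\cap\vec S^{ -n}[\![\psi]\!])$, $[\![\varphi\,\mathsf S\,\psi]\!]=\bigcup_{n\ge0}(\bigcap_{i<n}\vec S^{i}[\![\varphi]\!]\cap\vec S^{n}[\![\psi]\!])$. -}

module Defs where

open import Data.Nat using (ℕ; zero; suc; _<_)
open import Data.Product using (Σ; ∃; _×_; _,_)
open import Data.Sum using (_⊎_)
open import Relation.Nullary using (¬_)
open import Relation.Binary.PropositionalEquality using (_≡_)
open import Relation.Binary.Structures using (IsTotalOrder)
open import Function.Definitions using (Bijective)

infixr 6 _‵∧_
infixr 5 _‵∨_
infixr 4 _‵⇒_ _‵⇐_
infixr 7 _‵U_ _‵S_

data Formula : Set where
  var   : ℕ → Formula
  _‵∧_  : Formula → Formula → Formula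
  _‵∨_  : Formula → Formula → Formula
  _‵⇒_  : Formula → Formula → Formula
  _‵⇐_  : Formula → Formula → Formula
  ‵X    : Formula → Formula
  ‵Y    : Formula → Formula
  ‵G    : Formula → Formula
  ‵H    : Formula → Formula
  _‵U_  : Formula → Formula → Formula
  _‵S_  : Formula → Formula → Formula

data ImmSub : Formula → Formula → Set where
  ∧ˡ : ∀ {φ ψ} → ImmSub φ (φ ‵∧ ψ)
  ∧ʳ : ∀ {φ ψ} → ImmSub ψ (φ ‵∧ ψ)
  ∨ˡ : ∀ {φ ψ} → ImmSub φ (φ ‵∨ ψ)
  ∨ʳ : ∀ {φ ψ} → ImmSub ψ (φ ‵∨ ψ)
  ⇒ˡ : ∀ {φ ψ} → ImmSub φ (φ ‵⇒ ψ)
  ⇒ʳ : ∀ {φ ψ} → ImmSub ψ (φ ‵⇒ ψ)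
  ⇐ˡ : ∀ {φ ψ} → ImmSub φ (φ ‵⇐ ψ)
  ⇐ʳ : ∀ {φ ψ} → ImmSub ψ (φ ‵⇐ ψ)
  X₀ : ∀ {φ} → ImmSub φ (‵X φ)
  Y₀ : ∀ {φ} → ImmSub φ (‵Y φ)
  G₀ : ∀ {φ} → ImmSub φ (‵G φ)
  H₀ : ∀ {φ} → ImmSub φ (‵H φ)
  Uˡ : ∀ {φ ψ} → ImmSub φ (φ ‵U ψ)
  Uʳ : ∀ {φ ψ} → ImmSub ψ (φ ‵U ψ)
  Sˡ : ∀ {φ ψ} → ImmSub φ (φ ‵S ψ)
  Sʳ : ∀ {φ ψ} → ImmSub ψ (φ ‵S ψ)

SubClosed : (Formula → Set) → Set
SubClosed Sig = ∀ {φ ψ} → ImmSub ψ φ → Sig φ → Sig ψ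

iter : {A : Set} → ℕ → (A → A) → A → A
iter zero    f a = a
iter (suc n) f a = f (iter n f a)

record BiModel : Set₁ where
  field
    W       : Set
    T       : Set
    _≤_     : W → W → Set
    ≤-linear : IsTotalOrder _≡_ _≤_
    S       : T → T
    S-bij   : Bijective _≡_ _≡_ S
    V       : ℕ → W → T → Set
    V-down  : ∀ p {v w} t → v ≤ w → V p w t → V p v t

  -- (w , t) ∈ S⃗ⁿ[P]  (image of P under the n-th iterate of S⃗)
  Img : ℕ → (W → T → Set) → W → T → Set
  Img n P w t = ∃ λ u → iter n S u ≡ t × P w u

  ⟦_⟧ : Formula → W → T → Set
  ⟦ var p ⟧   w t = V p w t
  ⟦ φ ‵∧ ψ ⟧  w t = ⟦ φ ⟧ w t × ⟦ ψ ⟧ w t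
  ⟦ φ ‵∨ ψ ⟧  w t = ⟦ φ ⟧ w t ⊎ ⟦ ψ ⟧ w t
  ⟦ φ ‵⇒ ψ ⟧  w t = ∀ v → v ≤ w → ⟦ φ ⟧ v t → ⟦ ψ ⟧ v t
  ⟦ φ ‵⇐ ψ ⟧  w t = ∃ λ v → w ≤ v × ⟦ φ ⟧ v t × ¬ ⟦ ψ ⟧ v t
  ⟦ ‵X φ ⟧    w t = ⟦ φ ⟧ w (S t)
  ⟦ ‵Y φ ⟧    w t = Img 1 ⟦ φ ⟧ w t
  ⟦ ‵G φ ⟧    w t = ∀ n → ⟦ φ ⟧ w (iter n S t)
  ⟦ ‵H φ ⟧    w t = ∀ n → Img n ⟦ φ ⟧ w t
  ⟦ φ ‵U ψ ⟧  w t = ∃ λ n → (∀ i → i < n → ⟦ φ ⟧ w (iter i S t)) × ⟦ ψ ⟧ w (iter n S t)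
  ⟦ φ ‵S ψ ⟧  w t = ∃ λ n → (∀ i → i < n → Img i ⟦ φ ⟧ w t) × Img n ⟦ ψ ⟧ w t

  Falsifies : Formula → Set
  Falsifies φ = ∃ λ (x : W × T) → let (w , t) = x in ¬ ⟦ φ ⟧ w t

_⊆ᶠ_ : (Formula → Set) → (Formula → Set) → Set
A ⊆ᶠ B = ∀ φ → A φ → B φ

_≐ᶠ_ : (Formula → Set) → (Formula → Set) → Set
A ≐ᶠ B = A ⊆ᶠ B × B ⊆ᶠ A

module _ (Sig : Formula → Set) (M : BiModel) where
  open BiModel M

  Pt : Set
  Pt = W × T

  ℓ : Pt → Formula → Set
  ℓ (w , t) ψ = Sig ψ × ⟦ ψ ⟧ w t

  _≤ₓ_ : Pt → Pt → Set
  (w , t) ≤ₓ (w' , t') = t ≡ t' × w ≤ w'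

  Rₓ : Pt → Pt → Set
  Rₓ (w , t) (w' , t') = w ≡ w' × t' ≡ S t

  Comparable : Pt → Pt → Set
  Comparable x y = y ≤ₓ x ⊎ x ≤ₓ y

  L : Pt → (Formula → Set) → Set
  L x A = ∃ λ y → Comparable x y × (ℓ y ≐ᶠ A)

  LEq : Pt → Pt → Set₁
  LEq x y = (∀ A → L x A → L y A) × (∀ A → L y A → L x A)

  _∼_ : Pt → Pt → Set₁
  x ∼ y = (ℓ x ≐ᶠ ℓ y) × LEq x y

  -- The quotient Q, presented as a setoid: the carrier consists of
  -- representatives, equality of classes is ∼, and every structure
  -- relation below is invariant under ∼.
  record Quotient : Set₂ where
    field
      Carrier : Set
      _≈_     : Carrier → Carrier → Set₁
      _≤Q_    : Carrier → Carrier → Set₁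
      ℓQ      : Carrier → Formula → Set
      RQ      : Carrier → Carrier → Set₁
      R⁺Q     : Carrier → Carrier → Set₁

  quotient : Quotient
  quotient = record
    { Carrier = Pt
    ; _≈_     = _∼_
    ; _≤Q_    = λ x y → LEq x y × (ℓ y ⊆ᶠ ℓ x)
    ; ℓQ      = ℓ
    ; RQ      = RQ
    ; R⁺Q     = λ X Y → ∃ λ X₁ → ∃ λ X₂ → ∃ λ Y₁ → ∃ λ Y₂ →
                  ≤Q X₁ X × ≤Q X X₂ × ≤Q Y₁ Y × ≤Q Y Y₂ ×
                  RQ X₂ Y₁ × RQ X₁ Y₂
    }
    where
    ≤Q : Pt → Pt → Set₁
    ≤Q x y = LEq x y × (ℓ y ⊆ᶠ ℓ x)
    RQ : Pt → Pt → Set₁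
    RQ X Y = ∃ λ x → ∃ λ y → x ∼ X × y ∼ Y × Rₓ x y

  QFalsifies : Formula → Set
  QFalsifies φ = ∃ λ (X : Quotient.Carrier quotient) →
                   Sig φ × ¬ Quotient.ℓQ quotient X φ

{-# OPTIONS --safe #-}
module Submission where

open import Defs
open import Data.Product using (_×_; _,_)

module _ (Sig : Formula → Set) (M : BiModel) where
  open BiModel M

  falsifies⇒QFalsifies : ∀ {φ} → Sig φ → Falsifies φ → QFalsifies Sig M φ
  falsifies⇒QFalsifies φ∈Σ (x , x∉⟦φ⟧) = x , φ∈Σ , λ (_ , x∈⟦φ⟧) → x∉⟦φ⟧ x∈⟦φ⟧

  QFalsifies⇒falsifies : ∀ {φ} → QFalsifies Sig M φ → Falsifies φ
  QFalsifies⇒falsifies (x , φ∈Σ , φ∉ℓx) = x , λ x∈⟦φ⟧ → φ∉ℓx (φ∈Σ , x∈⟦φ⟧)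

proposition6p5 : (Sig : Formula → Set) → SubClosed Sig → (M : BiModel) → (φ : Formula) → Sig φ →
    (BiModel.Falsifies M φ → QFalsifies Sig M φ) × (QFalsifies Sig M φ → BiModel.Falsifies M φ)
proposition6p5 Sig _ M φ φ∈Σ = falsifies⇒QFalsifies Sig M φ∈Σ , QFalsifies⇒falsifies Sig M
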